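{- Let $r$ and $s$ be non-negative integers. Then \[ \mathbb A\tau ^r A_s (\tau ) + \mathbb B\sigma ^r A_s (\sigma ) = \frac{v_r }{2}\sum_{t = 0}^s A(s,t)w^* _t + \frac{u_r }{2}\sum_{t = 0}^s A(s,t)(w^* _{t + 1} - qw^* _{t - 1} ). \]
   Context: Let $a,b,q$ be complex numbers with $q\ne0$ and $1-4q\ne0$. Define $(w^*_j)$ by $w^*_0=a$, $w^*_1=b$, $w^*_j=w^*_{j-1}-qw^*_{j-2}$ for $j\ge2$, extended to negative indices by $w^*_{ -j}=(w^*_{ -j+1}-w^*_{ -j+2})/q$. Let $(u_j)$ and $(v_j)$ be the sequences obtained with $(a,b)=(0,1)$ and $(a,b)=(2,1)$ respectively. Let $\Delta=\sqrt{1-4q}$ (a fixed square root), $\tau=(1+\Delta)/2$, $\sigma=(1-\Delta)/2$, and $\mathbb A=(b-a\sigma)/(\tau-\sigma)$, $\mathbb B=(a\tau-b)/(\tau-\sigma)$. The Eulerian numbers are $A(i,j)=\sum_{t=0}^j(-1)^t\binom{i+1}{t}(j-t)^i$ for non-negative integers $i,j$ (with $0^0=1$), and $A_i(x)=\sum_{j=0}^iA(i,j)x^j$. -}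

module Defs where

open import Level using (Level)
open import Algebra.Bundles using (CommutativeRing)
open import Data.Nat as ℕ using (ℕ; zero; suc)
open import Data.Nat.Combinatorics using (_C_)
open import Data.Integer as ℤ using (ℤ; +_; -[1+_])
open import Data.Product using (_×_; _,_; proj₁)

-- Eulerian numbers  A(i,j) = Σ_{t=0}^{j} (-1)^t C(i+1,t) (j-t)^i   (in ℤ; ℕ's _^_ has 0^0 = 1)
signℤ : ℕ → ℤ
signℤ zero = + 1
signℤ (suc t) = ℤ.- signℤ t

sumℤ : ℕ → (ℕ → ℤ) → ℤ
sumℤ zero f = f 0
sumℤ (suc n) f = sumℤ n f ℤ.+ f (suc n)

Euler : ℕ → ℕ → ℤ
Euler i j = sumℤ j (λ t → signℤ t ℤ.* (+ ((suc i C t) ℕ.* ((j ℕ.∸ t) ℕ.^ i))))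

module Seq {c ℓ : Level} (R : CommutativeRing c ℓ) where
  open CommutativeRing R

  fromℕ : ℕ → Carrier
  fromℕ zero = 0#
  fromℕ (suc n) = 1# + fromℕ n

  fromℤ : ℤ → Carrier
  fromℤ (+ n) = fromℕ n
  fromℤ -[1+ n ] = - fromℕ (suc n)

  pow : Carrier → ℕ → Carrier
  pow x zero = 1#
  pow x (suc n) = x * pow x n

  sumR : ℕ → (ℕ → Carrier) → Carrier
  sumR zero f = f 0
  sumR (suc n) f = sumR n f + f (suc n)

  EulerPoly : ℕ → Carrier → Carrier
  EulerPoly i x = sumR i (λ j → fromℤ (Euler i j) * pow x j)

  -- Horadam-type sequence w*_j (a, b, q), with qi the inverse of q (used for negative indices)
  -- wPos n = (w_n , w_{n+1})
  wPos : (a b q : Carrier) → ℕ → Carrier × Carrier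
  wPos a b q zero = a , b
  wPos a b q (suc n) with wPos a b q n
  ... | x , y = y , (y - q * x)

  -- wNeg n = (w_{-n} , w_{-n+1}),  w_{-j} = (w_{-j+1} - w_{-j+2}) / q
  wNeg : (a b qi : Carrier) → ℕ → Carrier × Carrier
  wNeg a b qi zero = a , b
  wNeg a b qi (suc n) with wNeg a b qi n
  ... | x , y = ((x - y) * qi) , x

  w : (a b q qi : Carrier) → ℤ → Carrier
  w a b q qi (+ n) = proj₁ (wPos a b q n)
  w a b q qi -[1+ n ] = proj₁ (wNeg a b qi (suc n))

-- Both sides are linear in the Eulerian numbers, so it suffices to prove the identity term by
-- term. With τ + σ = 1 and τσ = q, the Binet form
-- w*ₙ = 𝔸τⁿ + 𝔹σⁿ gives w*ₜ₊₁ − q w*ₜ₋₁ = (τ − σ)(𝔸τᵗ − 𝔹σᵗ), while vᵣ = τʳ + σʳ and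
-- uᵣ = (τʳ − σʳ)/(τ − σ). Hence the t-th term on the right is
-- ½[(τʳ + σʳ)(𝔸τᵗ + 𝔹σᵗ) + (τʳ − σʳ)(𝔸τᵗ − 𝔹σᵗ)] = 𝔸τʳ⁺ᵗ + 𝔹σʳ⁺ᵗ, the t-th term on the left.
module Submission where

open import Defs
open import Algebra.Bundles using (CommutativeRing)
open import Algebra.Solver.Ring.AlmostCommutativeRing
  using (fromCommutativeRing; _-Raw-AlmostCommutative⟶_)
import Algebra.Properties.Ring as RingProperties
import Algebra.Properties.AbelianGroup as AbelianGroupProperties
import Algebra.Properties.CommutativeSemigroup as CommutativeSemigroupProperties
import Algebra.Properties.Semiring.Mult.TCOptimised as SemiringMult
open import Data.Nat as ℕ using (ℕ; zero; suc)
import Data.Nat.Properties as ℕ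
open import Data.Integer as ℤ using (ℤ; +_; -[1+_])
import Data.Integer.Properties as ℤ
open import Data.Sign as Sign using (Sign)
open import Data.Maybe using (Maybe; just; nothing)
open import Data.Product using (_×_; _,_; proj₁; proj₂)
open import Relation.Nullary using (¬_; yes; no)
open import Relation.Binary.PropositionalEquality as ≡ using (_≡_)
import Relation.Binary.Reasoning.Setoid as ≈-Reasoning

module IntegerCoefficientSolver {c ℓ} (R : CommutativeRing c ℓ) where
  open CommutativeRing R
  open RingProperties ring using (-1*x≈-x; -0#≈0#; -‿involutive)
  open AbelianGroupProperties +-abelianGroup using (⁻¹-∙-comm)
  open CommutativeSemigroupProperties +-commutativeSemigroup using (interchange)
  open CommutativeSemigroupProperties *-commutativeSemigroup using ()
    renaming (interchange to *-interchange)
  open SemiringMult semiring public using () renaming (_×_ to _×′_)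
  open SemiringMult semiring using (1+×; ×-homo-+; ×1-homo-*)
  open ≈-Reasoning setoid

  cast : ℤ → Carrier
  cast (+ n) = n ×′ 1#
  cast -[1+ n ] = - (suc n ×′ 1#)

  cast-⊖ : ∀ m n → cast (m ℤ.⊖ n) ≈ m ×′ 1# - n ×′ 1#
  cast-⊖ m zero = sym (trans (+-congˡ -0#≈0#) (+-identityʳ _))
  cast-⊖ zero (suc n) = sym (+-identityˡ _)
  cast-⊖ (suc m) (suc n) = begin
    cast (suc m ℤ.⊖ suc n)                 ≡⟨ ≡.cong cast (ℤ.[1+m]⊖[1+n]≡m⊖n m n) ⟩
    cast (m ℤ.⊖ n)                         ≈⟨ cast-⊖ m n ⟩
    m ×′ 1# - n ×′ 1#                        ≈⟨ sym (+-identityˡ _) ⟩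
    0# + (m ×′ 1# - n ×′ 1#)                 ≈⟨ +-congʳ (sym (-‿inverseʳ 1#)) ⟩
    (1# - 1#) + (m ×′ 1# - n ×′ 1#)          ≈⟨ interchange _ _ _ _ ⟩
    (1# + m ×′ 1#) + (- 1# - n ×′ 1#)        ≈⟨ +-congˡ (⁻¹-∙-comm _ _) ⟩
    (1# + m ×′ 1#) - (1# + n ×′ 1#)          ≈⟨ sym (+-cong (1+× m 1#) (-‿cong (1+× n 1#))) ⟩
    suc m ×′ 1# - suc n ×′ 1#                ∎

  cast-homo-+ : ∀ i j → cast (i ℤ.+ j) ≈ cast i + cast j
  cast-homo-+ (+ m) (+ n) = ×-homo-+ 1# m n
  cast-homo-+ (+ m) -[1+ n ] = cast-⊖ m (suc n)
  cast-homo-+ -[1+ m ] (+ n) = trans (cast-⊖ n (suc m)) (+-comm _ _)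
  cast-homo-+ -[1+ m ] -[1+ n ] = begin
    - (suc (suc (m ℕ.+ n)) ×′ 1#)           ≡⟨ ≡.cong (λ k → - (suc k ×′ 1#)) (≡.sym (ℕ.+-suc m n)) ⟩
    - ((suc m ℕ.+ suc n) ×′ 1#)             ≈⟨ -‿cong (×-homo-+ 1# (suc m) (suc n)) ⟩
    - (suc m ×′ 1# + suc n ×′ 1#)            ≈⟨ sym (⁻¹-∙-comm _ _) ⟩
    - (suc m ×′ 1#) - suc n ×′ 1#            ∎

  cast-homo-‿ : ∀ i → cast (ℤ.- i) ≈ - cast i
  cast-homo-‿ (+ zero) = sym -0#≈0#
  cast-homo-‿ (+ suc n) = refl
  cast-homo-‿ -[1+ n ] = sym (-‿involutive _)

  castSign : Sign → Carrier
  castSign Sign.+ = 1#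
  castSign Sign.- = - 1#

  castSign-homo-* : ∀ s t → castSign (s Sign.* t) ≈ castSign s * castSign t
  castSign-homo-* Sign.+ t = sym (*-identityˡ _)
  castSign-homo-* Sign.- Sign.+ = sym (*-identityʳ _)
  castSign-homo-* Sign.- Sign.- = sym (trans (-1*x≈-x _) (-‿involutive _))

  cast-◃ : ∀ s n → cast (s ℤ.◃ n) ≈ castSign s * (n ×′ 1#)
  cast-◃ s zero = sym (zeroʳ _)
  cast-◃ Sign.+ (suc n) = sym (*-identityˡ _)
  cast-◃ Sign.- (suc n) = sym (-1*x≈-x _)

  cast≈sign*abs : ∀ i → cast i ≈ castSign (ℤ.sign i) * (ℤ.∣ i ∣ ×′ 1#)
  cast≈sign*abs (+ n) = sym (*-identityˡ _)
  cast≈sign*abs -[1+ n ] = sym (-1*x≈-x _)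

  cast-homo-* : ∀ i j → cast (i ℤ.* j) ≈ cast i * cast j
  cast-homo-* i j = begin
    cast (s Sign.* t ℤ.◃ m ℕ.* n)          ≈⟨ cast-◃ (s Sign.* t) (m ℕ.* n) ⟩
    castSign (s Sign.* t) * ((m ℕ.* n) ×′ 1#)
      ≈⟨ *-cong (castSign-homo-* s t) (×1-homo-* m n) ⟩
    (castSign s * castSign t) * (m ×′ 1# * n ×′ 1#)
      ≈⟨ *-interchange _ _ _ _ ⟩
    (castSign s * m ×′ 1#) * (castSign t * n ×′ 1#)
      ≈⟨ sym (*-cong (cast≈sign*abs i) (cast≈sign*abs j)) ⟩
    cast i * cast j                        ∎
    where
    s = ℤ.sign i
    t = ℤ.sign j
    m = ℤ.∣ i ∣
    n = ℤ.∣ j ∣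

  castMorphism : ℤ.+-*-rawRing -Raw-AlmostCommutative⟶ fromCommutativeRing R
  castMorphism = record
    { ⟦_⟧ = cast
    ; +-homo = cast-homo-+
    ; *-homo = cast-homo-*
    ; -‿homo = cast-homo-‿
    ; 0-homo = refl
    ; 1-homo = refl
    }

  cast-≟ : ∀ i j → Maybe (cast i ≈ cast j)
  cast-≟ i j with i ℤ.≟ j
  ... | yes ≡.refl = just refl
  ... | no _ = nothing

  open import Algebra.Solver.Ring ℤ.+-*-rawRing (fromCommutativeRing R) castMorphism cast-≟ public

module Sequences {c ℓ} (R : CommutativeRing c ℓ) where
  open CommutativeRing R
  open Seq R
  open IntegerCoefficientSolver R
  open ≈-Reasoning setoid

  fromℕ≈cast : ∀ n → fromℕ n ≈ cast (+ n)
  fromℕ≈cast zero = refl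
  fromℕ≈cast (suc n) = trans (+-congˡ (fromℕ≈cast n)) (sym (SemiringMult.1+× semiring n 1#))

  sumR-cong : ∀ n {f g : ℕ → Carrier} → (∀ t → f t ≈ g t) → sumR n f ≈ sumR n g
  sumR-cong zero f≈g = f≈g 0
  sumR-cong (suc n) f≈g = +-cong (sumR-cong n f≈g) (f≈g (suc n))

  sumR-linear : ∀ n α β (f g : ℕ → Carrier) →
                α * sumR n f + β * sumR n g ≈ sumR n (λ t → α * f t + β * g t)
  sumR-linear zero α β f g = refl
  sumR-linear (suc n) α β f g = begin
    α * (sumR n f + f (suc n)) + β * (sumR n g + g (suc n))
      ≈⟨ solve 6 (λ α β F x G y → α :* (F :+ x) :+ β :* (G :+ y)
                                := (α :* F :+ β :* G) :+ (α :* x :+ β :* y)) refl α β _ _ _ _ ⟩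
    (α * sumR n f + β * sumR n g) + (α * f (suc n) + β * g (suc n))
      ≈⟨ +-congʳ (sumR-linear n α β f g) ⟩
    sumR n (λ t → α * f t + β * g t) + (α * f (suc n) + β * g (suc n)) ∎

  wPos-suc : ∀ a b q n → wPos a b q (suc n)
             ≡ (proj₂ (wPos a b q n) , proj₂ (wPos a b q n) - q * proj₁ (wPos a b q n))
  wPos-suc a b q n with wPos a b q n
  ... | x , y = ≡.refl

  roots-sum : ∀ Δ h → (1# + 1#) * h ≈ 1# → (1# + Δ) * h + (1# - Δ) * h ≈ 1#
  roots-sum Δ h 2h≈1 = trans
    (solve 2 (λ Δ h → (con (+ 1) :+ Δ) :* h :+ (con (+ 1) :- Δ) :* h := con (+ 2) :* h) refl Δ h)
    2h≈1

  roots-product : ∀ Δ h q → (1# + 1#) * h ≈ 1# → Δ * Δ ≈ 1# - fromℕ 4 * q →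
                  ((1# + Δ) * h) * ((1# - Δ) * h) ≈ q
  roots-product Δ h q 2h≈1 Δ²≈1-4q = begin
    ((1# + Δ) * h) * ((1# - Δ) * h)
      ≈⟨ solve 2 (λ Δ h → ((con (+ 1) :+ Δ) :* h) :* ((con (+ 1) :- Δ) :* h)
                        := (con (+ 1) :- Δ :* Δ) :* (h :* h)) refl Δ h ⟩
    (1# - Δ * Δ) * (h * h)
      ≈⟨ *-congʳ (+-congˡ (-‿cong (trans Δ²≈1-4q (+-congˡ (-‿cong (*-congʳ (fromℕ≈cast 4))))))) ⟩
    (1# - (1# - cast (+ 4) * q)) * (h * h)
      ≈⟨ solve 2 (λ q h → (con (+ 1) :- (con (+ 1) :- con (+ 4) :* q)) :* (h :* h)
                        := q :* (con (+ 2) :* h) :* (con (+ 2) :* h)) refl q h ⟩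
    q * ((1# + 1#) * h) * ((1# + 1#) * h)
      ≈⟨ trans (*-cong (*-congˡ 2h≈1) 2h≈1) (trans (*-identityʳ _) (*-identityʳ _)) ⟩
    q ∎

  -- ½[(P + Q)(AX + BY) + (P − Q)(AX − BY)] = APX + BQY, with ½ = h and 1/(τ − σ) = di.
  polarization : ∀ {h di τ σ} → (1# + 1#) * h ≈ 1# → (τ - σ) * di ≈ 1# → ∀ A B P Q X Y e →
    (1# * P + 1# * Q) * h * (e * (A * X + B * Y))
      + (di * P + (- di) * Q) * h * (e * ((τ - σ) * (A * X - B * Y)))
    ≈ A * P * (e * X) + B * Q * (e * Y)
  polarization {h} {di} {τ} {σ} 2h≈1 [τ-σ]di≈1 A B P Q X Y e = begin
    (1# * P + 1# * Q) * h * (e * (A * X + B * Y))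
      + (di * P + (- di) * Q) * h * (e * ((τ - σ) * (A * X - B * Y)))
      ≈⟨ solve 11 (λ A B P Q X Y e h di τ σ →
           (con (+ 1) :* P :+ con (+ 1) :* Q) :* h :* (e :* (A :* X :+ B :* Y))
             :+ (di :* P :+ (:- di) :* Q) :* h :* (e :* ((τ :- σ) :* (A :* X :- B :* Y)))
           := h :* (e :* ((P :+ Q) :* (A :* X :+ B :* Y)
                           :+ ((τ :- σ) :* di) :* ((P :- Q) :* (A :* X :- B :* Y)))))
           refl A B P Q X Y e h di τ σ ⟩
    h * (e * ((P + Q) * (A * X + B * Y) + ((τ - σ) * di) * ((P - Q) * (A * X - B * Y))))
      ≈⟨ *-congˡ (*-congˡ (+-congˡ (*-congʳ [τ-σ]di≈1))) ⟩
    h * (e * ((P + Q) * (A * X + B * Y) + 1# * ((P - Q) * (A * X - B * Y))))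
      ≈⟨ solve 8 (λ A B P Q X Y e h →
           h :* (e :* ((P :+ Q) :* (A :* X :+ B :* Y) :+ con (+ 1) :* ((P :- Q) :* (A :* X :- B :* Y))))
           := (con (+ 2) :* h) :* (A :* P :* (e :* X) :+ B :* Q :* (e :* Y)))
           refl A B P Q X Y e h ⟩
    ((1# + 1#) * h) * (A * P * (e * X) + B * Q * (e * Y))
      ≈⟨ trans (*-congʳ 2h≈1) (*-identityˡ _) ⟩
    A * P * (e * X) + B * Q * (e * Y) ∎

  module Binet (q τ σ : Carrier) (τ+σ≈1 : τ + σ ≈ 1#) (τσ≈q : τ * σ ≈ q) where

    record BinetCoefficients (a b A B : Carrier) : Set ℓ where
      constructor binetCoefficients
      field
        binet₀ : A + B ≈ a
        binet₁ : A * τ + B * σ ≈ b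

    binet-recurrence : ∀ A B P Q → A * (τ * (τ * P)) + B * (σ * (σ * Q))
                                   ≈ (A * (τ * P) + B * (σ * Q)) - q * (A * P + B * Q)
    binet-recurrence A B P Q = begin
      A * (τ * (τ * P)) + B * (σ * (σ * Q))
        ≈⟨ solve 6 (λ A B P Q τ σ → A :* (τ :* (τ :* P)) :+ B :* (σ :* (σ :* Q))
              := (τ :+ σ) :* (A :* (τ :* P) :+ B :* (σ :* Q)) :- (τ :* σ) :* (A :* P :+ B :* Q))
              refl A B P Q τ σ ⟩
      (τ + σ) * (A * (τ * P) + B * (σ * Q)) - (τ * σ) * (A * P + B * Q)
        ≈⟨ +-cong (trans (*-congʳ τ+σ≈1) (*-identityˡ _)) (-‿cong (*-congʳ τσ≈q)) ⟩
      (A * (τ * P) + B * (σ * Q)) - q * (A * P + B * Q) ∎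

    module _ {a b A B : Carrier} (coefficients : BinetCoefficients a b A B) where
      open BinetCoefficients coefficients

      wPos-binet : ∀ n → (proj₁ (wPos a b q n) ≈ A * pow τ n + B * pow σ n)
                         × (proj₂ (wPos a b q n) ≈ A * pow τ (suc n) + B * pow σ (suc n))
      wPos-binet zero =
        sym (trans (+-cong (*-identityʳ A) (*-identityʳ B)) binet₀) ,
        sym (trans (+-cong (*-congˡ (*-identityʳ τ)) (*-congˡ (*-identityʳ σ))) binet₁)
      wPos-binet (suc n) rewrite wPos-suc a b q n =
        proj₂ (wPos-binet n) ,
        trans (+-cong (proj₂ (wPos-binet n)) (-‿cong (*-congˡ (proj₁ (wPos-binet n)))))
              (sym (binet-recurrence A B (pow τ n) (pow σ n)))

      w-binet : ∀ qi n → w a b q qi (+ n) ≈ A * pow τ n + B * pow σ n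
      w-binet qi n = proj₁ (wPos-binet n)

      w[t+1]-q*w[t-1]-binet : ∀ {qi} → q * qi ≈ 1# → ∀ t →
        w a b q qi (+ suc t) - q * w a b q qi (+ t ℤ.- + 1)
        ≈ (τ - σ) * (A * pow τ t - B * pow σ t)
      w[t+1]-q*w[t-1]-binet {qi} q*qi≈1 zero = begin
        b - q * ((a - b) * qi)
          ≈⟨ solve 4 (λ a b q qi → b :- q :* ((a :- b) :* qi) := b :- (q :* qi) :* (a :- b))
                     refl a b q qi ⟩
        b - (q * qi) * (a - b)
          ≈⟨ +-congˡ (-‿cong (*-congʳ q*qi≈1)) ⟩
        b - 1# * (a - b)
          ≈⟨ solve 2 (λ a b → b :- con (+ 1) :* (a :- b) := con (+ 2) :* b :- a :* con (+ 1))
                     refl a b ⟩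
        (1# + 1#) * b - a * 1#
          ≈⟨ +-cong (*-congˡ (sym binet₁)) (-‿cong (*-cong (sym binet₀) (sym τ+σ≈1))) ⟩
        (1# + 1#) * (A * τ + B * σ) - (A + B) * (τ + σ)
          ≈⟨ solve 4 (λ A B τ σ → con (+ 2) :* (A :* τ :+ B :* σ) :- (A :+ B) :* (τ :+ σ)
                               := (τ :- σ) :* (A :* con (+ 1) :- B :* con (+ 1))) refl A B τ σ ⟩
        (τ - σ) * (A * 1# - B * 1#) ∎
      w[t+1]-q*w[t-1]-binet q*qi≈1 (suc t) = begin
        proj₁ (wPos a b q (suc (suc t))) - q * proj₁ (wPos a b q t)
          ≈⟨ +-cong (proj₁ (wPos-binet (suc (suc t))))
                    (-‿cong (*-cong (sym τσ≈q) (proj₁ (wPos-binet t)))) ⟩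
        (A * (τ * (τ * P)) + B * (σ * (σ * Q))) - (τ * σ) * (A * P + B * Q)
          ≈⟨ solve 6 (λ A B P Q τ σ →
                (A :* (τ :* (τ :* P)) :+ B :* (σ :* (σ :* Q))) :- (τ :* σ) :* (A :* P :+ B :* Q)
                := (τ :- σ) :* (A :* (τ :* P) :- B :* (σ :* Q))) refl A B P Q τ σ ⟩
        (τ - σ) * (A * (τ * P) - B * (σ * Q)) ∎
        where
        P = pow τ t
        Q = pow σ t

    horadam-coefficients : ∀ {a b di} → (τ - σ) * di ≈ 1# →
                           BinetCoefficients a b ((b - a * σ) * di) ((a * τ - b) * di)
    horadam-coefficients {a} {b} {di} [τ-σ]di≈1 = binetCoefficients
      (trans (solve 5 (λ a b τ σ di → (b :- a :* σ) :* di :+ (a :* τ :- b) :* di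
                                   := a :* ((τ :- σ) :* di)) refl a b τ σ di)
            (trans (*-congˡ [τ-σ]di≈1) (*-identityʳ a)))
      (trans (solve 5 (λ a b τ σ di → (b :- a :* σ) :* di :* τ :+ (a :* τ :- b) :* di :* σ
                                   := b :* ((τ :- σ) :* di)) refl a b τ σ di)
            (trans (*-congˡ [τ-σ]di≈1) (*-identityʳ b)))

    lucasU-coefficients : ∀ {di} → (τ - σ) * di ≈ 1# → BinetCoefficients 0# 1# di (- di)
    lucasU-coefficients {di} [τ-σ]di≈1 = binetCoefficients
      (solve 1 (λ di → di :+ :- di := con (+ 0)) refl di)
      (trans (solve 3 (λ di τ σ → di :* τ :+ (:- di) :* σ := (τ :- σ) :* di) refl di τ σ) [τ-σ]di≈1)

    lucasV-coefficients : BinetCoefficients (1# + 1#) 1# 1# 1#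
    lucasV-coefficients = binetCoefficients refl (trans (+-cong (*-identityˡ τ) (*-identityˡ σ)) τ+σ≈1)

    addition-formula : ∀ {a b qi h di} → q * qi ≈ 1# → (1# + 1#) * h ≈ 1# → (τ - σ) * di ≈ 1# →
      ∀ r t e →
      w (1# + 1#) 1# q qi (+ r) * h * (e * w a b q qi (+ t))
        + w 0# 1# q qi (+ r) * h * (e * (w a b q qi (+ suc t) - q * w a b q qi (+ t ℤ.- + 1)))
      ≈ (b - a * σ) * di * pow τ r * (e * pow τ t) + (a * τ - b) * di * pow σ r * (e * pow σ t)
    addition-formula {a} {b} {qi} {h} {di} q*qi≈1 2h≈1 [τ-σ]di≈1 r t e = trans
      (+-cong (*-cong (*-congʳ (w-binet lucasV-coefficients qi r)) (*-congˡ (w-binet horadam qi t)))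
              (*-cong (*-congʳ (w-binet (lucasU-coefficients [τ-σ]di≈1) qi r))
                      (*-congˡ (w[t+1]-q*w[t-1]-binet horadam q*qi≈1 t))))
      (polarization 2h≈1 [τ-σ]di≈1 _ _ (pow τ r) (pow σ r) (pow τ t) (pow σ t) e)
      where
      horadam : BinetCoefficients a b ((b - a * σ) * di) ((a * τ - b) * di)
      horadam = horadam-coefficients [τ-σ]di≈1

lemma5 : ∀ {c ℓ} (R : CommutativeRing c ℓ) →
    let open CommutativeRing R
        open Seq R
    in (a b q qi Δ h di : Carrier) →
       q * qi ≈ 1# →
       ¬ (1# - fromℕ 4 * q ≈ 0#) →
       (1# + 1#) * h ≈ 1# →
       Δ * Δ ≈ 1# - fromℕ 4 * q →
       let τ = (1# + Δ) * h
           σ = (1# - Δ) * h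
       in (τ - σ) * di ≈ 1# →
       let 𝔸 = (b - a * σ) * di
           𝔹 = (a * τ - b) * di
           ws = w a b q qi
           u = w 0# 1# q qi
           v = w (1# + 1#) 1# q qi
       in (r s : ℕ) →
          𝔸 * pow τ r * EulerPoly s τ + 𝔹 * pow σ r * EulerPoly s σ
          ≈ v (+ r) * h * sumR s (λ t → fromℤ (Euler s t) * ws (+ t))
            + u (+ r) * h * sumR s (λ t → fromℤ (Euler s t) * (ws (+ suc t) - q * ws (+ t ℤ.- + 1)))
lemma5 R a b q qi Δ h di q*qi≈1 _ 2h≈1 Δ²≈1-4q [τ-σ]di≈1 r s = begin
  𝔸 * pow τ r * EulerPoly s τ + 𝔹 * pow σ r * EulerPoly s σ
    ≈⟨ sumR-linear s _ _ _ _ ⟩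
  sumR s (λ t → 𝔸 * pow τ r * (E t * pow τ t) + 𝔹 * pow σ r * (E t * pow σ t))
    ≈⟨ sumR-cong s (λ t → sym (addition-formula q*qi≈1 2h≈1 [τ-σ]di≈1 r t (E t))) ⟩
  sumR s (λ t → v r * h * (E t * ws t) + u r * h * (E t * (ws (suc t) - q * wsPred t)))
    ≈⟨ sym (sumR-linear s _ _ _ _) ⟩
  v r * h * sumR s (λ t → E t * ws t) + u r * h * sumR s (λ t → E t * (ws (suc t) - q * wsPred t)) ∎
  where
  open CommutativeRing R
  open Seq R
  open Sequences R
  open ≈-Reasoning setoid
  τ σ 𝔸 𝔹 : Carrier
  τ = (1# + Δ) * h
  σ = (1# - Δ) * h
  𝔸 = (b - a * σ) * di
  𝔹 = (a * τ - b) * di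
  E : ℕ → Carrier
  E t = fromℤ (Euler s t)
  ws wsPred u v : ℕ → Carrier
  ws n = w a b q qi (+ n)
  wsPred n = w a b q qi (+ n ℤ.- + 1)
  u n = w 0# 1# q qi (+ n)
  v n = w (1# + 1#) 1# q qi (+ n)
  open Binet q τ σ (roots-sum Δ h 2h≈1) (roots-product Δ h q 2h≈1 Δ²≈1-4q)
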